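{- Define an array $(T_{m,n})_{m\ge 0,\,n\ge 0}$ of positive integers as follows. The cells are filled one at a time, antidiagonal by antidiagonal: first all cells with $m+n=0$, then those with $m+n=1$, then $m+n=2$, and so on; within the antidiagonal $m+n=s$ the cells are filled in the order $(s,0),(s-1,1),\dots,(0,s)$. Each cell $(m,n)$, when filled, receives the smallest positive integer that does not already occur in any previously filled cell $(m',n')$ with $m'=m$ (same row), or $n'=n$ (same column), or $m'-n'=m-n$ (same diagonal), or $m'+n'=m+n$ (same antidiagonal). Then for every fixed $m\ge 0$ the row $n\mapsto T_{m,n}$ is a bijection from $\{0,1,2,\dots\}$ onto the positive integers, and for every fixed $n\ge0$ the column $m\mapsto T_{m,n}$ is a bijection from $\{0,1,2,\dots\}$ onto the positive integers.
   Context: This is the "infinite Sudoku" array of OEIS A269526, whose top-left corner begins with rows $1,3,2,6,\dots$; $2,4,5,1,\dots$; $3,1,6,2,\dots$. -}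

module Defs where

open import Data.Nat using (ℕ; zero; suc; _+_; _*_; _≡ᵇ_)
open import Data.Nat.Base using (_/_)
open import Data.Bool using (Bool; true; false; if_then_else_; _∨_)
open import Data.List using (List; []; _∷_; _++_; length; map; filter; any)
open import Data.Product using (_×_; _,_)

next : ℕ × ℕ → ℕ × ℕ
next (zero  , n) = (suc n , 0)
next (suc m , n) = (m , suc n)

cellOf : ℕ → ℕ × ℕ
cellOf zero    = (0 , 0)
cellOf (suc k) = next (cellOf k)

index : ℕ → ℕ → ℕ
index m n = ((m + n) * suc (m + n)) / 2 + n

elemᵇ : ℕ → List ℕ → Bool
elemᵇ v []       = false
elemᵇ v (x ∷ xs) = if v ≡ᵇ x then true else elemᵇ v xs

-- Among the length xs + 1
-- candidates 1,...,length xs + 1 at least one is missing from xs, so the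
-- bounded search below always returns the true minimum.
mexFrom : ℕ → ℕ → List ℕ → ℕ
mexFrom zero       c xs = c
mexFrom (suc fuel) c xs = if elemᵇ c xs then mexFrom fuel (suc c) xs else c

mex : List ℕ → ℕ
mex xs = mexFrom (length xs) 1 xs

relatedᵇ : ℕ × ℕ → ℕ × ℕ → Bool
relatedᵇ (m' , n') (m , n) =
  (m' ≡ᵇ m) ∨ (n' ≡ᵇ n) ∨ ((m' + n) ≡ᵇ (m + n')) ∨ ((m' + n') ≡ᵇ (m + n))

Cell : Set
Cell = (ℕ × ℕ) × ℕ

forbidden : ℕ × ℕ → List Cell → List ℕ
forbidden p [] = []
forbidden p ((q , v) ∷ cs) =
  if relatedᵇ q p then v ∷ forbidden p cs else forbidden p cs

mutual
  filled : ℕ → List Cell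
  filled zero    = []
  filled (suc k) = filled k ++ ((cellOf k , value k) ∷ [])

  value : ℕ → ℕ
  value k = mex (forbidden (cellOf k) (filled k))

T : ℕ → ℕ → ℕ
T m n = value (index m n)

-- Each cell receives a value different from those of the earlier cells on its
-- row, column, diagonal and antidiagonal, so rows and columns are injective.
-- Surjectivity is proved by induction on the line and on the value v. Far
-- enough down column n, all smaller values already occur in the column and v
-- already occurs high up in every earlier column; the earlier cells related to
-- such a cell lie in column n or in earlier columns at large rows, so the
-- greedy rule writes v. Along row m the same works, except that v may be
-- blocked by a cell further down the antidiagonal, which is filled first. If
-- that happened at every cell of a long stretch of row m, v would occupy a long
-- run of consecutive antidiagonals; but a set with at most one cell per row
-- and per column meets at most (S + 2)(S + 1) - 1 consecutive antidiagonals
-- starting from the S-th.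

module Submission where

open import Defs
open import Data.Bool as Bool using (true; false; _∨_)
open import Data.Bool.Properties using (T-∨)
open import Data.Empty using (⊥)
open import Data.Fin using (Fin; toℕ; fromℕ<)
open import Data.Fin.Properties
  using (injective⇒≤; toℕ-injective; toℕ<n; fromℕ<-injective; ¬∀⟶∃¬)
open import Data.List using (List; []; _∷_; length; lookup)
open import Data.List.Membership.Propositional using (_∈_; _∉_)
open import Data.List.Membership.Propositional.Properties using (∈-++⁺ˡ; ∈-++⁺ʳ; ∈-++⁻)
open import Data.List.Relation.Unary.Any as Any using (here; there)
open import Data.List.Relation.Unary.Any.Properties using (lookup-index)
open import Data.Nat using (ℕ; zero; suc; _+_; _*_; _≤_; _<_; _≡ᵇ_; _/_; z≤n; s≤s; s≤s⁻¹)
open import Data.Nat.Properties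
open import Data.List.Membership.DecPropositional _≟_ using (_∈?_)
open import Data.Nat.DivMod using (+-distrib-/-∣ʳ; m*n/n≡m)
open import Data.Nat.Divisibility using (divides)
open import Data.Nat.Induction using (<-rec)
open import Data.Nat.Tactic.RingSolver using (solve-∀)
open import Data.Product as Prod using (_×_; _,_; proj₁; proj₂; ∃; ∃₂; uncurry)
open import Data.Product.Relation.Binary.Lex.Strict using (×-Lex; ×-transitive; ×-asymmetric)
open import Data.Sum using (_⊎_; inj₁; inj₂; [_,_]′; map₂)
open import Data.Unit using (tt)
open import Function using (_∘_; Injective; Equivalence)
open import Relation.Nullary using (¬_; Dec; yes; no; Reflects; ofʸ; ofⁿ; proof; contradiction)
open import Relation.Nullary.Decidable using (map′)
open import Relation.Binary.Definitions using (tri<; tri≈; tri>)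
open import Relation.Binary.PropositionalEquality

-- The minimal excludant

length-≥-injection : ∀ {A : Set} {L} (xs : List A) (f : Fin L → A) →
  Injective _≡_ _≡_ f → (∀ i → f i ∈ xs) → L ≤ length xs
length-≥-injection xs f f-injective f∈xs = injective⇒≤ position-injective
  where
  position : Fin _ → Fin (length xs)
  position i = Any.index (f∈xs i)

  position-injective : Injective _≡_ _≡_ position
  position-injective {i} {j} eq = f-injective (begin
    f i                    ≡⟨ lookup-index (f∈xs i) ⟩
    lookup xs (position i) ≡⟨ cong (lookup xs) eq ⟩
    lookup xs (position j) ≡⟨ lookup-index (f∈xs j) ⟨
    f j                    ∎)
    where open ≡-Reasoning

≡ᵇ-reflects : ∀ m n → Reflects (m ≡ n) (m ≡ᵇ n)
≡ᵇ-reflects m n = proof (m ≟ n)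

elemᵇ-reflects : ∀ v xs → Reflects (v ∈ xs) (elemᵇ v xs)
elemᵇ-reflects v [] = ofⁿ λ ()
elemᵇ-reflects v (x ∷ xs) with v ≡ᵇ x | ≡ᵇ-reflects v x
... | true  | ofʸ v≡x = ofʸ (here v≡x)
... | false | ofⁿ v≢x with elemᵇ v xs | elemᵇ-reflects v xs
...   | true  | ofʸ v∈xs = ofʸ (there v∈xs)
...   | false | ofⁿ v∉xs = ofⁿ λ { (here v≡x) → v≢x v≡x ; (there v∈xs) → v∉xs v∈xs }

mexFrom-≥ : ∀ fuel c xs → c ≤ mexFrom fuel c xs
mexFrom-≥ zero       c xs = ≤-refl
mexFrom-≥ (suc fuel) c xs with elemᵇ c xs
... | true  = ≤-trans (n≤1+n c) (mexFrom-≥ fuel (suc c) xs)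
... | false = ≤-refl

mexFrom-skips-members : ∀ fuel c xs u → c ≤ u → u < mexFrom fuel c xs → u ∈ xs
mexFrom-skips-members zero c xs u c≤u u<c = contradiction c≤u (<⇒≱ u<c)
mexFrom-skips-members (suc fuel) c xs u c≤u u<mex with elemᵇ c xs | elemᵇ-reflects c xs
... | false | _ = contradiction c≤u (<⇒≱ u<mex)
... | true  | ofʸ c∈xs with m≤n⇒m<n∨m≡n c≤u
...   | inj₁ c<u  = mexFrom-skips-members fuel (suc c) xs u c<u u<mex
...   | inj₂ refl = c∈xs

mexFrom-∉-or-exhausted : ∀ fuel c xs → mexFrom fuel c xs ∉ xs ⊎ mexFrom fuel c xs ≡ c + fuel
mexFrom-∉-or-exhausted zero c xs = inj₂ (sym (+-identityʳ c))
mexFrom-∉-or-exhausted (suc fuel) c xs with elemᵇ c xs | elemᵇ-reflects c xs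
... | false | ofⁿ c∉xs = inj₁ c∉xs
... | true  | _ = map₂ (λ eq → trans eq (sym (+-suc c fuel)))
                      (mexFrom-∉-or-exhausted fuel (suc c) xs)

mex-positive : ∀ xs → 1 ≤ mex xs
mex-positive xs = mexFrom-≥ (length xs) 1 xs

mex-minimal : ∀ xs u → 1 ≤ u → u < mex xs → u ∈ xs
mex-minimal xs = mexFrom-skips-members (length xs) 1 xs

-- The search only tries 1, …, 1 + length xs; if it were exhausted with its
-- last candidate in xs, xs would contain 1 + length xs distinct values.
mex-∉ : ∀ xs → mex xs ∉ xs
mex-∉ xs mex∈xs with mexFrom-∉-or-exhausted (length xs) 1 xs
... | inj₁ mex∉xs = mex∉xs mex∈xs
... | inj₂ mex≡ = 1+n≰n (length-≥-injection xs (suc ∘ toℕ) (toℕ-injective ∘ suc-injective) member)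
  where
  member : ∀ i → suc (toℕ i) ∈ xs
  member i with m≤n⇒m<n∨m≡n (subst (suc (toℕ i) ≤_) (sym mex≡) (toℕ<n i))
  ... | inj₁ i<mex = mex-minimal xs _ (s≤s z≤n) i<mex
  ... | inj₂ i≡mex = subst (_∈ xs) (sym i≡mex) mex∈xs

mex-unique : ∀ xs v → 1 ≤ v → v ∉ xs → (∀ u → 1 ≤ u → u < v → u ∈ xs) → mex xs ≡ v
mex-unique xs v 1≤v v∉xs below with <-cmp (mex xs) v
... | tri< mex<v _ _ = contradiction (below _ (mex-positive xs) mex<v) (mex-∉ xs)
... | tri≈ _ mex≡v _ = mex≡v
... | tri> _ _ v<mex = contradiction (mex-minimal xs v 1≤v v<mex) v∉xs

-- The filling order

triangle-step : ∀ s → (suc s * suc (suc s)) / 2 ≡ (s * suc s) / 2 + suc s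
triangle-step s = begin
  (suc s * suc (suc s)) / 2       ≡⟨ cong (_/ 2) (doubled s) ⟩
  (s * suc s + suc s * 2) / 2     ≡⟨ +-distrib-/-∣ʳ (s * suc s) (divides (suc s) refl) ⟩
  (s * suc s) / 2 + suc s * 2 / 2 ≡⟨ cong ((s * suc s) / 2 +_) (m*n/n≡m (suc s) 2) ⟩
  (s * suc s) / 2 + suc s         ∎
  where
  open ≡-Reasoning
  doubled : ∀ s → suc s * suc (suc s) ≡ s * suc s + suc s * 2
  doubled = solve-∀

index-next : ∀ p → uncurry index (next p) ≡ suc (uncurry index p)
index-next (zero , n) = begin
  ((suc n + 0) * suc (suc n + 0)) / 2 + 0 ≡⟨ +-identityʳ _ ⟩
  ((suc n + 0) * suc (suc n + 0)) / 2     ≡⟨ cong (λ s → (s * suc s) / 2) (+-identityʳ (suc n)) ⟩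
  (suc n * suc (suc n)) / 2               ≡⟨ triangle-step n ⟩
  (n * suc n) / 2 + suc n                 ≡⟨ +-suc _ n ⟩
  suc ((n * suc n) / 2 + n)               ∎
  where open ≡-Reasoning
index-next (suc m , n) rewrite +-suc m n = +-suc _ n

index-cellOf : ∀ k → uncurry index (cellOf k) ≡ k
index-cellOf zero    = refl
index-cellOf (suc k) = trans (index-next (cellOf k)) (cong suc (index-cellOf k))

cellOf-walk : ∀ n k m → cellOf k ≡ (m + n , 0) → cellOf (n + k) ≡ (m , n)
cellOf-walk zero    k m start = trans start (cong (_, 0) (+-identityʳ m))
cellOf-walk (suc n) k m start =
  cong next (cellOf-walk n k (suc m) (trans start (cong (_, 0) (+-suc m n))))

cellOf-antidiagonal-start : ∀ s → ∃ λ k → cellOf k ≡ (s , 0)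
cellOf-antidiagonal-start zero = 0 , refl
cellOf-antidiagonal-start (suc s) with cellOf-antidiagonal-start s
... | k , start = suc (s + k) , cong next (cellOf-walk s k 0 start)

cellOf-index : ∀ p → cellOf (uncurry index p) ≡ p
cellOf-index (m , n) with cellOf-antidiagonal-start (m + n)
... | k , start = begin
  cellOf (index m n)                      ≡⟨ cong (cellOf ∘ uncurry index) walked ⟨
  cellOf (uncurry index (cellOf (n + k))) ≡⟨ cong cellOf (index-cellOf (n + k)) ⟩
  cellOf (n + k)                          ≡⟨ walked ⟩
  (m , n)                                 ∎
  where
  open ≡-Reasoning
  walked : cellOf (n + k) ≡ (m , n)
  walked = cellOf-walk n k m start

index-injective : ∀ {p q} → uncurry index p ≡ uncurry index q → p ≡ q
index-injective {p} {q} eq = trans (sym (cellOf-index p)) (trans (cong cellOf eq) (cellOf-index q))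

fillKey : ℕ × ℕ → ℕ × ℕ
fillKey (m , n) = (m + n , n)

infix 4 _≺_
_≺_ : ℕ × ℕ → ℕ × ℕ → Set
p ≺ q = ×-Lex _≡_ _<_ _<_ (fillKey p) (fillKey q)

≺-trans : ∀ {p q r} → p ≺ q → q ≺ r → p ≺ r
≺-trans {p} {q} {r} =
  ×-transitive {_≈₁_ = _≡_} {_<₂_ = _<_} isEquivalence <-resp₂-≡ <-trans <-trans
    {fillKey p} {fillKey q} {fillKey r}

≺-asym : ∀ {p q} → p ≺ q → ¬ q ≺ p
≺-asym {p} {q} =
  ×-asymmetric {_≈₁_ = _≡_} {_<₂_ = _<_} sym <-resp₂-≡ <-asym <-asym {fillKey p} {fillKey q}

≺-next : ∀ p → p ≺ next p
≺-next (zero  , n) = inj₁ (<-≤-trans (n<1+n n) (m≤m+n (suc n) 0))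
≺-next (suc m , n) = inj₂ (sym (+-suc m n) , n<1+n n)

cellOf-≺ : ∀ {j k} → j < k → cellOf j ≺ cellOf k
cellOf-≺ {j} {suc k} j<1+k with m<1+n⇒m<n∨m≡n j<1+k
... | inj₁ j<k  = ≺-trans (cellOf-≺ j<k) (≺-next (cellOf k))
... | inj₂ refl = ≺-next (cellOf j)

index<⇒≺ : ∀ {p q} → uncurry index p < uncurry index q → p ≺ q
index<⇒≺ {p} {q} lt = subst₂ _≺_ (cellOf-index p) (cellOf-index q) (cellOf-≺ lt)

≺⇒index< : ∀ {p q} → p ≺ q → uncurry index p < uncurry index q
≺⇒index< {p} {q} p≺q with <-cmp (uncurry index p) (uncurry index q)
... | tri< lt _ _ = lt
... | tri≈ _ eq _ = contradiction (subst (_≺ q) (index-injective eq) p≺q) (λ q≺q → ≺-asym q≺q q≺q)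
... | tri> _ _ gt = contradiction (index<⇒≺ gt) (≺-asym p≺q)

-- The greedy rule

data Related : ℕ × ℕ → ℕ × ℕ → Set where
  same-row          : ∀ {a b m n} → a ≡ m → Related (a , b) (m , n)
  same-column       : ∀ {a b m n} → b ≡ n → Related (a , b) (m , n)
  same-diagonal     : ∀ {a b m n} → a + n ≡ m + b → Related (a , b) (m , n)
  same-antidiagonal : ∀ {a b m n} → a + b ≡ m + n → Related (a , b) (m , n)

Related-sym : ∀ {p q} → Related p q → Related q p
Related-sym (same-row eq)          = same-row (sym eq)
Related-sym (same-column eq)       = same-column (sym eq)
Related-sym (same-diagonal eq)     = same-diagonal (sym eq)
Related-sym (same-antidiagonal eq) = same-antidiagonal (sym eq)

∨-elim : ∀ x y → Bool.T (x ∨ y) → Bool.T x ⊎ Bool.T y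
∨-elim x y = Equivalence.to (T-∨ {x} {y})

∨-introˡ : ∀ x y → Bool.T x → Bool.T (x ∨ y)
∨-introˡ x y = Equivalence.from (T-∨ {x} {y}) ∘ inj₁

∨-introʳ : ∀ x y → Bool.T y → Bool.T (x ∨ y)
∨-introʳ x y = Equivalence.from (T-∨ {x} {y}) ∘ inj₂

module _ {a b m n : ℕ} where
  private
    row col diag anti : Bool.Bool
    row  = a ≡ᵇ m
    col  = b ≡ᵇ n
    diag = (a + n) ≡ᵇ (m + b)
    anti = (a + b) ≡ᵇ (m + n)

  relatedᵇ⇒Related : Bool.T (relatedᵇ (a , b) (m , n)) → Related (a , b) (m , n)
  relatedᵇ⇒Related =
    [ same-row ∘ ≡ᵇ⇒≡ a m
    , [ same-column ∘ ≡ᵇ⇒≡ b n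
      , [ same-diagonal ∘ ≡ᵇ⇒≡ (a + n) (m + b)
        , same-antidiagonal ∘ ≡ᵇ⇒≡ (a + b) (m + n)
        ]′ ∘ ∨-elim diag anti
      ]′ ∘ ∨-elim col (diag ∨ anti)
    ]′ ∘ ∨-elim row (col ∨ diag ∨ anti)

  Related⇒relatedᵇ : Related (a , b) (m , n) → Bool.T (relatedᵇ (a , b) (m , n))
  Related⇒relatedᵇ (same-row eq) =
    ∨-introˡ row _ (≡⇒≡ᵇ a m eq)
  Related⇒relatedᵇ (same-column eq) =
    ∨-introʳ row _ (∨-introˡ col _ (≡⇒≡ᵇ b n eq))
  Related⇒relatedᵇ (same-diagonal eq) =
    ∨-introʳ row _ (∨-introʳ col _ (∨-introˡ diag anti (≡⇒≡ᵇ _ _ eq)))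
  Related⇒relatedᵇ (same-antidiagonal eq) =
    ∨-introʳ row _ (∨-introʳ col _ (∨-introʳ diag anti (≡⇒≡ᵇ _ _ eq)))

∈-forbidden⁺ : ∀ {p q v} cs → (q , v) ∈ cs → Related q p → v ∈ forbidden p cs
∈-forbidden⁺ {p} ((q′ , v′) ∷ cs) q∈ rel with relatedᵇ q′ p in related | q∈
... | true  | here refl   = here refl
... | true  | there q∈cs  = there (∈-forbidden⁺ cs q∈cs rel)
... | false | here refl   = contradiction (subst Bool.T related (Related⇒relatedᵇ rel)) λ ()
... | false | there q∈cs  = ∈-forbidden⁺ cs q∈cs rel

∈-forbidden⁻ : ∀ {p v} cs → v ∈ forbidden p cs → ∃ λ q → (q , v) ∈ cs × Related q p
∈-forbidden⁻ {p} ((q , v′) ∷ cs) v∈ with relatedᵇ q p in related | v∈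
... | true  | here refl  = q , here refl , relatedᵇ⇒Related (subst Bool.T (sym related) tt)
... | true  | there v∈cs = Prod.map₂ (Prod.map₁ there) (∈-forbidden⁻ cs v∈cs)
... | false | v∈cs       = Prod.map₂ (Prod.map₁ there) (∈-forbidden⁻ cs v∈cs)

∈-filled⁺ : ∀ {j k} → j < k → (cellOf j , value j) ∈ filled k
∈-filled⁺ {j} {suc k} j<1+k with m<1+n⇒m<n∨m≡n j<1+k
... | inj₁ j<k  = ∈-++⁺ˡ (∈-filled⁺ j<k)
... | inj₂ refl = ∈-++⁺ʳ (filled j) (here refl)

∈-filled⁻ : ∀ {c} k → c ∈ filled k → ∃ λ j → j < k × c ≡ (cellOf j , value j)
∈-filled⁻ (suc k) c∈ with ∈-++⁻ (filled k) c∈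
... | inj₂ (here eq) = k , n<1+n k , eq
... | inj₁ c∈filled with ∈-filled⁻ k c∈filled
...   | j , j<k , eq = j , m<n⇒m<1+n j<k , eq

forbiddenAt : ℕ → ℕ → List ℕ
forbiddenAt m n = forbidden (m , n) (filled (index m n))

T≡mex : ∀ m n → T m n ≡ mex (forbiddenAt m n)
T≡mex m n = cong (λ c → mex (forbidden c (filled (index m n)))) (cellOf-index (m , n))

Forbids : ℕ → ℕ → ℕ → Set
Forbids m n v = ∃₂ λ a b → (a , b) ≺ (m , n) × Related (a , b) (m , n) × T a b ≡ v

forbids⇒∈ : ∀ {m n v} → Forbids m n v → v ∈ forbiddenAt m n
forbids⇒∈ {m} {n} (a , b , ab≺mn , rel , refl) =
  ∈-forbidden⁺ (filled (index m n))
    (subst (λ c → (c , T a b) ∈ filled (index m n)) (cellOf-index (a , b)) (∈-filled⁺ (≺⇒index< ab≺mn)))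
    rel

∈⇒forbids : ∀ {m n v} → v ∈ forbiddenAt m n → Forbids m n v
∈⇒forbids {m} {n} v∈ with ∈-forbidden⁻ (filled (index m n)) v∈
... | q , q∈ , rel with ∈-filled⁻ (index m n) q∈
...   | j , j<k , refl =
  proj₁ (cellOf j) , proj₂ (cellOf j) ,
  subst (cellOf j ≺_) (cellOf-index (m , n)) (cellOf-≺ j<k) , rel , cong value (index-cellOf j)

forbids? : ∀ m n v → Dec (Forbids m n v)
forbids? m n v = map′ ∈⇒forbids forbids⇒∈ (v ∈? forbiddenAt m n)

T-positive : ∀ m n → 1 ≤ T m n
T-positive m n = subst (1 ≤_) (sym (T≡mex m n)) (mex-positive (forbiddenAt m n))

T-unforbidden : ∀ m n → ¬ Forbids m n (T m n)
T-unforbidden m n forbids =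
  mex-∉ (forbiddenAt m n) (subst (_∈ forbiddenAt m n) (T≡mex m n) (forbids⇒∈ forbids))

T≡least-unforbidden : ∀ m n v → 1 ≤ v → ¬ Forbids m n v →
  (∀ u → 1 ≤ u → u < v → Forbids m n u) → T m n ≡ v
T≡least-unforbidden m n v 1≤v unforbidden below =
  trans (T≡mex m n) (mex-unique (forbiddenAt m n) v 1≤v (unforbidden ∘ ∈⇒forbids)
    (λ u 1≤u u<v → forbids⇒∈ (below u 1≤u u<v)))

T-related-distinct : ∀ {a b m n} → (a , b) ≢ (m , n) → Related (a , b) (m , n) → T a b ≢ T m n
T-related-distinct {a} {b} {m} {n} ab≢mn rel Tab≡Tmn with <-cmp (index a b) (index m n)
... | tri< lt _ _ = T-unforbidden m n (a , b , index<⇒≺ lt , rel , Tab≡Tmn)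
... | tri≈ _ eq _ = ab≢mn (index-injective eq)
... | tri> _ _ gt = T-unforbidden a b (m , n , index<⇒≺ gt , Related-sym rel , sym Tab≡Tmn)

row-injective : ∀ m n n′ → T m n ≡ T m n′ → n ≡ n′
row-injective m n n′ eq with n ≟ n′
... | yes n≡n′ = n≡n′
... | no  n≢n′ =
  contradiction eq (T-related-distinct {m} {n} {m} {n′} (n≢n′ ∘ cong proj₂) (same-row refl))

column-injective : ∀ m m′ n → T m n ≡ T m′ n → m ≡ m′
column-injective m m′ n eq with m ≟ m′
... | yes m≡m′ = m≡m′
... | no  m≢m′ =
  contradiction eq (T-related-distinct {m} {n} {m′} {n} (m≢m′ ∘ cong proj₁) (same-column refl))

earlier-diagonal-column : ∀ {a b m n} → (a , b) ≺ (m , n) → a + n ≡ m + b → b < n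
earlier-diagonal-column (inj₂ (_ , b<n)) _ = b<n
earlier-diagonal-column {a} {b} {m} {n} (inj₁ ab<mn) an≡mb = ≰⇒> λ n≤b →
  <-irrefl an≡mb (≤-<-trans (+-monoʳ-≤ a n≤b) (<-≤-trans ab<mn (+-monoʳ-≤ m n≤b)))

earlier-related-column : ∀ {a b m n} → (a , b) ≺ (m , n) → Related (a , b) (m , n) →
  b ≡ n ⊎ (b < n × m ≤ a + n)
earlier-related-column _ (same-column b≡n) = inj₁ b≡n
earlier-related-column {a} {b} {n = n} (inj₁ ab<an) (same-row refl) =
  inj₂ (+-cancelˡ-< a b n ab<an , m≤m+n a n)
earlier-related-column {a} {n = n} (inj₂ (_ , b<n)) (same-row refl) = inj₂ (b<n , m≤m+n a n)
earlier-related-column {b = b} {m} ab≺mn (same-diagonal an≡mb) =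
  inj₂ (earlier-diagonal-column ab≺mn an≡mb , subst (m ≤_) (sym an≡mb) (m≤m+n m b))
earlier-related-column (inj₁ ab<mn) (same-antidiagonal ab≡mn) = contradiction ab≡mn (<⇒≢ ab<mn)
earlier-related-column {a} {m = m} {n} (inj₂ (_ , b<n)) (same-antidiagonal ab≡mn) =
  inj₂ (b<n , ≤-trans (m≤m+n m n) (subst (_≤ a + n) ab≡mn (+-monoʳ-≤ a (<⇒≤ b<n))))

earlier-related-row : ∀ {a b m n} → (a , b) ≺ (m , n) → Related (a , b) (m , n) →
  a ≡ m ⊎ (m < a × a + b ≡ m + n) ⊎ (a < m × n ≤ m + b)
earlier-related-row _ (same-row a≡m) = inj₁ a≡m
earlier-related-row {a} {m = m} {n} (inj₁ an<mn) (same-column refl) =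
  inj₂ (inj₂ (+-cancelʳ-< n a m an<mn , m≤n+m n m))
earlier-related-row (inj₂ (_ , n<n)) (same-column refl) = contradiction n<n (<-irrefl refl)
earlier-related-row {a} {b} {m} {n} ab≺mn (same-diagonal an≡mb)
  with earlier-related-column ab≺mn (same-diagonal an≡mb)
... | inj₁ refl = inj₁ (+-cancelʳ-≡ b a m an≡mb)
... | inj₂ (b<n , _) = inj₂ (inj₂
      ( +-cancelʳ-< n a m (subst (_< m + n) (sym an≡mb) (+-monoʳ-< m b<n))
      , subst (n ≤_) an≡mb (m≤n+m n a) ))
earlier-related-row (inj₁ ab<mn) (same-antidiagonal ab≡mn) = contradiction ab≡mn (<⇒≢ ab<mn)
earlier-related-row {a} {m = m} (inj₂ (_ , b<n)) (same-antidiagonal ab≡mn) with <-cmp a m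
... | tri< a<m _ _ = contradiction ab≡mn (<⇒≢ (+-mono-< a<m b<n))
... | tri≈ _ a≡m _ = inj₁ a≡m
... | tri> _ _ m<a = inj₂ (inj₁ (m<a , ab≡mn))

uniform-bound : ∀ {Q : ℕ → ℕ → Set} K → (∀ i → i < K → ∃ (Q i)) →
  ∃ λ N → ∀ i → i < K → ∃ λ x → x < N × Q i x
uniform-bound zero _ = 0 , λ _ ()
uniform-bound {Q} (suc K) witness
  with uniform-bound K (λ i i<K → witness i (m<n⇒m<1+n i<K)) | witness K (n<1+n K)
... | N , below-N | x , Qx = N + suc x , bounded
  where
  bounded : ∀ i → i < suc K → ∃ λ y → y < N + suc x × Q i y
  bounded i i<1+K with m<1+n⇒m<n∨m≡n i<1+K
  ... | inj₂ refl = x , <-≤-trans (n<1+n x) (m≤n+m (suc x) N) , Qx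
  ... | inj₁ i<K with below-N i i<K
  ...   | y , y<N , Qy = y , <-≤-trans y<N (m≤m+n N (suc x)) , Qy

raise-bound : ∀ {Q : ℕ → ℕ → Set} {K N N′} → N ≤ N′ →
  (∀ i → i < K → ∃ λ x → x < N × Q i x) → ∀ i → i < K → ∃ λ x → x < N′ × Q i x
raise-bound N≤N′ bounded i i<K with bounded i i<K
... | x , x<N , Qx = x , <-≤-trans x<N N≤N′ , Qx

either-or-all-below : ∀ {A : Set} {B : ℕ → Set} → (∀ i → A ⊎ B i) → ∀ K → A ⊎ (∀ i → i < K → B i)
either-or-all-below step zero = inj₂ λ _ ()
either-or-all-below step (suc K) with either-or-all-below step K | step K
... | inj₁ a | _ = inj₁ a
... | inj₂ _ | inj₁ a = inj₁ a
... | inj₂ below | inj₂ BK = inj₂ λ i i<1+K → [ below i , (λ { refl → BK }) ]′ (m<1+n⇒m<n∨m≡n i<1+K)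

-- Placements with at most one cell per row and per column

Occupied : (ℕ → ℕ → Set) → ℕ → Set
Occupied P s = ∃₂ λ a b → a + b ≡ s × P a b

module Placement (P : ℕ → ℕ → Set)
  (row-unique : ∀ {a b b′} → P a b → P a b′ → b ≡ b′)
  (column-unique : ∀ {a a′ b} → P a b → P a′ b → a ≡ a′) where

  -- The occupied cells on antidiagonals S, …, S + L lie in distinct columns,
  -- so one of them lies in a column ≥ L, hence in a row ≤ S.
  module _ (S L : ℕ) (occupied : ∀ i → i ≤ L → Occupied P (S + i)) where
    private
      cell : (i : Fin (suc L)) → Occupied P (S + toℕ i)
      cell i = occupied (toℕ i) (s≤s⁻¹ (toℕ<n i))

      row column : Fin (suc L) → ℕ
      row i = proj₁ (cell i)
      column i = proj₁ (proj₂ (cell i))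

      on-antidiagonal : ∀ i → row i + column i ≡ S + toℕ i
      on-antidiagonal i = proj₁ (proj₂ (proj₂ (cell i)))

      occupant : ∀ i → P (row i) (column i)
      occupant i = proj₂ (proj₂ (proj₂ (cell i)))

      column-injective′ : ∀ {i j} → column i ≡ column j → i ≡ j
      column-injective′ {i} {j} eq = toℕ-injective (+-cancelˡ-≡ S _ _ (begin
        S + toℕ i         ≡⟨ on-antidiagonal i ⟨
        row i + column i  ≡⟨ cong₂ _+_ rows eq ⟩
        row j + column j  ≡⟨ on-antidiagonal j ⟩
        S + toℕ j         ∎))
        where
        open ≡-Reasoning
        rows : row i ≡ row j
        rows = column-unique (occupant i) (subst (P (row j)) (sym eq) (occupant j))

      not-all-narrow : ¬ (∀ i → column i < L)
      not-all-narrow narrow = 1+n≰n (injective⇒≤ {f = λ i → fromℕ< (narrow i)}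
        (column-injective′ ∘ fromℕ<-injective _ _ (narrow _) (narrow _)))

    wide-cell : ∃₂ λ a b → P a b × a ≤ S × L ≤ b × b ≤ S + L
    wide-cell with ¬∀⟶∃¬ (suc L) (λ i → column i < L) (λ i → column i <? L) not-all-narrow
    ... | i , L≮b = row i , column i , occupant i , a≤S , L≤b , b≤S+L
      where
      L≤b : L ≤ column i
      L≤b = ≮⇒≥ L≮b
      ab≤S+L : row i + column i ≤ S + L
      ab≤S+L = subst (_≤ S + L) (sym (on-antidiagonal i)) (+-monoʳ-≤ S (s≤s⁻¹ (toℕ<n i)))
      a≤S : row i ≤ S
      a≤S = +-cancelʳ-≤ L (row i) S (≤-trans (+-monoʳ-≤ (row i) L≤b) ab≤S+L)
      b≤S+L : column i ≤ S + L
      b≤S+L = ≤-trans (m≤n+m (column i) (row i)) ab≤S+L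

  -- Apply wide-cell to S + 2 runs starting at multiples of S + 1: this gives
  -- S + 2 cells in rows ≤ S whose columns lie in pairwise disjoint windows.
  module _ (S : ℕ) (occupied : ∀ i → i < suc (suc S) * suc S → Occupied P (S + i)) where
    private
      width : ℕ
      width = suc S

      windowed : (j : Fin (suc (suc S))) →
        ∃₂ λ a b → P a b × a ≤ S × toℕ j * width ≤ b × b ≤ S + toℕ j * width
      windowed j = wide-cell S (toℕ j * width)
        (λ i i≤ → occupied i (≤-<-trans i≤ (*-monoˡ-< width (toℕ<n j))))

      row column : Fin (suc (suc S)) → ℕ
      row j = proj₁ (windowed j)
      column j = proj₁ (proj₂ (windowed j))

      occupant : ∀ j → P (row j) (column j)
      occupant j = proj₁ (proj₂ (proj₂ (windowed j)))

      row≤S : ∀ j → row j ≤ S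
      row≤S j = proj₁ (proj₂ (proj₂ (proj₂ (windowed j))))

      column-≥ : ∀ j → toℕ j * width ≤ column j
      column-≥ j = proj₁ (proj₂ (proj₂ (proj₂ (proj₂ (windowed j)))))

      column-≤ : ∀ j → column j ≤ S + toℕ j * width
      column-≤ j = proj₂ (proj₂ (proj₂ (proj₂ (proj₂ (windowed j)))))

      -- s≤s (column-≤ k) : column k < suc (toℕ k) * width, definitionally.
      window-≤ : ∀ {j k} → column j ≡ column k → toℕ j ≤ toℕ k
      window-≤ {j} {k} eq = s≤s⁻¹ (*-cancelʳ-< width (toℕ j) (suc (toℕ k))
        (≤-<-trans (column-≥ j) (subst (_< suc (toℕ k) * width) (sym eq) (s≤s (column-≤ k)))))

      row-injective′ : Injective _≡_ _≡_ (λ j → fromℕ< (s≤s (row≤S j)))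
      row-injective′ {j} {k} eq = toℕ-injective (≤-antisym (window-≤ columns) (window-≤ (sym columns)))
        where
        rows : row j ≡ row k
        rows = fromℕ<-injective _ _ (s≤s (row≤S j)) (s≤s (row≤S k)) eq
        columns : column j ≡ column k
        columns = row-unique (occupant j) (subst (λ a → P a (column k)) (sym rows) (occupant k))

    occupied-runs-are-short : ⊥
    occupied-runs-are-short = 1+n≰n (injective⇒≤ row-injective′)

-- Surjectivity

column-step : ∀ n w N →
  (∀ b → b < n → ∃ λ a → a < N × T a b ≡ suc w) →
  (∀ u → u < w → ∃ λ a → a < N × T a n ≡ suc u) →
  ∃ λ a → T a n ≡ suc w
column-step n w N earlier-columns smaller-values with forbids? (N + n) n (suc w)
... | no unforbidden =
  N + n , T≡least-unforbidden (N + n) n (suc w) (s≤s z≤n) unforbidden smaller-forbidden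
  where
  smaller-forbidden : ∀ u → 1 ≤ u → u < suc w → Forbids (N + n) n u
  smaller-forbidden (suc u) _ u<w with smaller-values u (s≤s⁻¹ u<w)
  ... | x , x<N , Txn≡ =
    x , n , inj₁ (<-≤-trans (+-monoˡ-< n x<N) (+-monoˡ-≤ n (m≤m+n N n))) , same-column refl , Txn≡
... | yes (a , b , ab≺ , rel , Tab≡) with earlier-related-column ab≺ rel
...   | inj₁ refl = a , Tab≡
...   | inj₂ (b<n , N+n≤a+n) with earlier-columns b b<n
...     | x , x<N , Txb≡ = contradiction N+n≤a+n (<⇒≱ (+-monoˡ-< n a<N))
  where
  a<N : a < N
  a<N = subst (_< N) (sym (column-injective a x b (trans Tab≡ (sym Txb≡)))) x<N

row-cell : ∀ m w N n → m + N ≤ n →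
  (∀ a → a < m → ∃ λ b → b < N × T a b ≡ suc w) →
  (∀ u → u < w → ∃ λ b → b < N × T m b ≡ suc u) →
  (∃ λ b → T m b ≡ suc w) ⊎ Occupied (λ a b → T a b ≡ suc w) (m + n)
row-cell m w N n m+N≤n earlier-rows smaller-values with forbids? m n (suc w)
... | no unforbidden =
  inj₁ (n , T≡least-unforbidden m n (suc w) (s≤s z≤n) unforbidden smaller-forbidden)
  where
  smaller-forbidden : ∀ u → 1 ≤ u → u < suc w → Forbids m n u
  smaller-forbidden (suc u) _ u<w with smaller-values u (s≤s⁻¹ u<w)
  ... | x , x<N , Tmx≡ =
    m , x , inj₁ (+-monoʳ-< m (<-≤-trans x<N (≤-trans (m≤n+m N m) m+N≤n))) , same-row refl , Tmx≡
... | yes (a , b , ab≺ , rel , Tab≡) with earlier-related-row ab≺ rel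
...   | inj₁ refl = inj₁ (b , Tab≡)
...   | inj₂ (inj₁ (_ , ab≡mn)) = inj₂ (a , b , ab≡mn , Tab≡)
...   | inj₂ (inj₂ (a<m , n≤m+b)) with earlier-rows a a<m
...     | x , x<N , Tax≡ = contradiction n≤m+b (<⇒≱ (<-≤-trans (+-monoʳ-< m b<N) m+N≤n))
  where
  b<N : b < N
  b<N = subst (_< N) (sym (row-injective a b x (trans Tab≡ (sym Tax≡)))) x<N

row-step : ∀ m w N →
  (∀ a → a < m → ∃ λ b → b < N × T a b ≡ suc w) →
  (∀ u → u < w → ∃ λ b → b < N × T m b ≡ suc u) →
  ∃ λ b → T m b ≡ suc w
row-step m w N earlier-rows smaller-values
  with either-or-all-below
         (λ i → row-cell m w N (m + N + i) (m≤m+n (m + N) i) earlier-rows smaller-values)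
         (suc (suc (m + (m + N))) * suc (m + (m + N)))
... | inj₁ found = found
... | inj₂ occupied = contradiction
  (λ i i<W → subst (Occupied _) (sym (+-assoc m (m + N) i)) (occupied i i<W))
  (Placement.occupied-runs-are-short (λ a b → T a b ≡ suc w)
    (λ {a} {b} {b′} p q → row-injective a b b′ (trans p (sym q)))
    (λ {a} {a′} {b} p q → column-injective a a′ b (trans p (sym q)))
    (m + (m + N)))

column-surjective : ∀ n v → 1 ≤ v → ∃ λ m → T m n ≡ v
column-surjective n (suc w) _ = <-rec (λ n → ∀ w → ∃ λ m → T m n ≡ suc w)
  (λ n earlier-columns → <-rec (λ w → ∃ λ m → T m n ≡ suc w) λ w smaller-values →
    let N₁ , earlier = uniform-bound n (λ b b<n → earlier-columns b<n w)
        N₂ , smaller = uniform-bound w (λ u u<w → smaller-values u<w)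
    in column-step n w (N₁ + N₂) (raise-bound (m≤m+n N₁ N₂) earlier) (raise-bound (m≤n+m N₂ N₁) smaller))
  n w

row-surjective : ∀ m v → 1 ≤ v → ∃ λ n → T m n ≡ v
row-surjective m (suc w) _ = <-rec (λ m → ∀ w → ∃ λ n → T m n ≡ suc w)
  (λ m earlier-rows → <-rec (λ w → ∃ λ n → T m n ≡ suc w) λ w smaller-values →
    let N₁ , earlier = uniform-bound m (λ a a<m → earlier-rows a<m w)
        N₂ , smaller = uniform-bound w (λ u u<w → smaller-values u<w)
    in row-step m w (N₁ + N₂) (raise-bound (m≤m+n N₁ N₂) earlier) (raise-bound (m≤n+m N₂ N₁) smaller))
  m w

mainTheorem2 :
    ((m : ℕ) →
      ((n : ℕ) → 1 ≤ T m n)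
      × ((n n' : ℕ) → T m n ≡ T m n' → n ≡ n')
      × ((v : ℕ) → 1 ≤ v → ∃ λ n → T m n ≡ v))
    × ((n : ℕ) →
      ((m : ℕ) → 1 ≤ T m n)
      × ((m m' : ℕ) → T m n ≡ T m' n → m ≡ m')
      × ((v : ℕ) → 1 ≤ v → ∃ λ m → T m n ≡ v))
mainTheorem2 =
  (λ m → T-positive m , row-injective m , row-surjective m) ,
  (λ n → (λ m → T-positive m n) , (λ m m′ → column-injective m m′ n) , column-surjective n)
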